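{- Let $\mathcal{P}$ be a finite set of propositional symbols and $\varphi$ an $\mathrm{LDL}_f$ formula over $\mathcal{P}$. Let $\mathsf{pref}_{\varphi}$ and $\mathsf{pref}_{\neg\varphi}$ be regular expressions over $2^{\mathcal{P}}$ (built from propositional formulae with $+$, $;$, $^*$, without tests) with $\mathcal{L}(\mathsf{pref}_{\varphi})=\mathcal{L}_{\mathit{poss\_good}}(\varphi)$ and $\mathcal{L}(\mathsf{pref}_{\neg\varphi})=\mathcal{L}_{\mathit{poss\_good}}(\neg\varphi)$. Then for every finite trace $\pi$: (1) $\varphi$ is in RV state $\mathit{temp\_true}$ on $\pi$ iff $\pi\models\varphi\wedge\langle\mathsf{pref}_{\neg\varphi}\rangle\mathit{end}$; (2) $\varphi$ is in RV state $\mathit{temp\_false}$ on $\pi$ iff $\pi\models\neg\varphi\wedge\langle\mathsf{pref}_{\varphi}\rangle\mathit{end}$; (3) $\varphi$ is in RV state $\mathit{perm\_true}$ on $\pi$ iff $\pi\models\langle\mathsf{pref}_{\varphi}\rangle\mathit{end}\wedge\neg\langle\mathsf{pref}_{\neg\varphi}\rangle\mathit{end}$; (4) $\varphi$ is in RV state $\mathit{perm\_false}$ on $\pi$ iff $\pi\models\langle\mathsf{pref}_{\neg\varphi}\rangle\mathit{end}\wedge\neg\langle\mathsf{pref}_{\varphi}\rangle\mathit{end}$.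
   Context: A trace is a finite, possibly empty, sequence $\pi=\pi_0,\dots,\pi_n$ of elements of $2^{\mathcal{P}}$; $\mathit{length}(\pi)=n+1$ ($0$ for the empty trace $\epsilon$), $\pi(i)=\pi_i$, and $\pi(i,j)=\pi_i,\dots,\pi_{j-1}$ (equal to $\pi(i,\mathit{length}(\pi))$ if $j>\mathit{length}(\pi)$, and to $\epsilon$ if $j\le i$). $\pi\pi'$ denotes concatenation of traces. $\mathrm{LDL}_f$ formulae and path expressions are given by $\varphi ::= \mathtt{true}\mid\mathtt{false}\mid\neg\varphi\mid\varphi_1\wedge\varphi_2\mid\varphi_1\vee\varphi_2\mid\langle\rho\rangle\varphi\mid[\rho]\varphi$ and $\rho ::= \phi\mid\varphi?\mid\rho_1+\rho_2\mid\rho_1;\rho_2\mid\rho^*$, where $\phi$ ranges over propositional formulae over $\mathcal{P}$. Semantics at position $i\ge 0$: $\pi,i\models\mathtt{true}$; $\pi,i\not\models\mathtt{false}$; Boolean connectives as usual; $\pi,i\models\langle\rho\rangle\varphi$ iff for some $j\ge i$, $\pi(i,j)\in\mathcal{L}(\rho)$ and $\pi,j\models\varphi$; $\pi,i\models[\rho]\varphi$ iff for all $j\ge i$ with $\pi(i,j)\in\mathcal{L}(\rho)$, $\pi,j\models\varphi$. Here $\pi(i,j)\in\mathcal{L}(\phi)$ iff $j=i+1$, $i<\mathit{length}(\pi)$ and $\pi(i)\models\phi$; $\pi(i,j)\in\mathcal{L}(\varphi?)$ iff $j=i$ and $\pi,i\models\varphi$; $\pi(i,j)\in\mathcal{L}(\rho_1+\rho_2)$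 iff it is in $\mathcal{L}(\rho_1)$ or $\mathcal{L}(\rho_2)$; $\pi(i,j)\in\mathcal{L}(\rho_1;\rho_2)$ iff for some $k$, $\pi(i,k)\in\mathcal{L}(\rho_1)$ and $\pi(k,j)\in\mathcal{L}(\rho_2)$; $\pi(i,j)\in\mathcal{L}(\rho^*)$ iff $j=i$ or for some $k$, $\pi(i,k)\in\mathcal{L}(\rho)$ and $\pi(k,j)\in\mathcal{L}(\rho^*)$. We write $\pi\models\varphi$ for $\pi,0\models\varphi$, and $\mathcal{L}(\varphi)=\{\pi\mid\pi\models\varphi\}$. The abbreviation $\mathit{end}$ stands for $[\mathit{true}]\mathtt{false}$ ($\mathit{true}$ the propositional tautology). For a test-free regular expression $\rho$, $\mathcal{L}(\rho)$ also denotes its usual language of finite traces (a propositional formula $\phi$ matches the one-letter traces $\Pi$ with $\Pi\models\phi$). $\mathcal{L}_{\mathit{poss\_good}}(\varphi)=\{\pi\mid \exists\pi'.\ \pi\pi'\in\mathcal{L}(\varphi)\}$ ($\pi'$ ranges over finite traces, including $\epsilon$). RV states: $\varphi$ is in state $\mathit{temp\_true}$ on $\pi$ if $\pi\models\varphi$ and some $\pi'$ has $\pi\pi'\not\models\varphi$; in $\mathit{temp\_false}$ if $\pi\not\models\varphi$ and some $\pi'$ has $\pi\pi'\models\varphi$; in $\mathit{perm\_true}$ if $\pi\models\varphi$ and every $\pi'$ has $\pi\pi'\models\varphi$; in $\mathit{perm\_false}$ if $\pi\not\models\varphi$ and every $\pi'$ has $\pi\pi'\not\models\varphi$ ($\pi'$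 ranging over finite traces, including $\epsilon$). -}

module Defs where

open import Data.Nat using (ℕ; zero; suc; _≤_)
open import Data.Fin using (Fin)
open import Data.Bool using (Bool; true; false; T)
open import Data.List using (List; []; _∷_; _++_; [_])
open import Data.Maybe using (Maybe; just; nothing)
open import Data.Product using (Σ; ∃; ∃-syntax; _×_; _,_)
open import Data.Sum using (_⊎_)
open import Data.Unit using (⊤)
open import Data.Empty using (⊥)
open import Relation.Nullary using (¬_)
open import Relation.Binary.PropositionalEquality using (_≡_)
open import Relation.Binary.Construct.Closure.ReflexiveTransitive using (Star)

-- Propositional symbols: 𝒫 = Fin n (a finite set).
-- Letters: elements of 2^𝒫, i.e. truth assignments Fin n → Bool.
Letter : ℕ → Set
Letter n = Fin n → Bool

Trace : ℕ → Set
Trace n = List (Letter n)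

data Prop (n : ℕ) : Set where
  atom  : Fin n → Prop n
  ptrue pfalse : Prop n
  pnot  : Prop n → Prop n
  pand por : Prop n → Prop n → Prop n

_⊨ₚ_ : ∀ {n} → Letter n → Prop n → Set
Π ⊨ₚ atom p = T (Π p)
Π ⊨ₚ ptrue = ⊤
Π ⊨ₚ pfalse = ⊥
Π ⊨ₚ pnot φ = ¬ (Π ⊨ₚ φ)
Π ⊨ₚ pand φ ψ = (Π ⊨ₚ φ) × (Π ⊨ₚ ψ)
Π ⊨ₚ por φ ψ = (Π ⊨ₚ φ) ⊎ (Π ⊨ₚ ψ)

mutual
  data Form (n : ℕ) : Set where
    tt ff : Form n
    ¬' : Form n → Form n
    _∧'_ _∨'_ : Form n → Form n → Form n
    ⟨_⟩_ : Path n → Form n → Form n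
    [_]'_ : Path n → Form n → Form n

  data Path (n : ℕ) : Set where
    prop : Prop n → Path n
    test : Form n → Path n
    _+'_ _⨾_ : Path n → Path n → Path n
    _* : Path n → Path n

at : ∀ {n} → Trace n → ℕ → Maybe (Letter n)
at [] _ = nothing
at (x ∷ π) zero = just x
at (x ∷ π) (suc i) = at π i

mutual
  Sat : ∀ {n} → Trace n → ℕ → Form n → Set
  Sat π i tt = ⊤
  Sat π i ff = ⊥
  Sat π i (¬' φ) = ¬ Sat π i φ
  Sat π i (φ ∧' ψ) = Sat π i φ × Sat π i ψ
  Sat π i (φ ∨' ψ) = Sat π i φ ⊎ Sat π i ψ
  Sat π i (⟨ ρ ⟩ φ) = ∃[ j ] (i ≤ j × Match π ρ i j × Sat π j φ)
  Sat π i ([ ρ ]' φ) = ∀ j → i ≤ j → Match π ρ i j → Sat π j φ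

  Match : ∀ {n} → Trace n → Path n → ℕ → ℕ → Set
  Match π (prop φ) i j = j ≡ suc i × ∃[ Π ] (at π i ≡ just Π × Π ⊨ₚ φ)
  Match π (test φ) i j = j ≡ i × Sat π i φ
  Match π (ρ₁ +' ρ₂) i j = Match π ρ₁ i j ⊎ Match π ρ₂ i j
  Match π (ρ₁ ⨾ ρ₂) i j = ∃[ k ] (Match π ρ₁ i k × Match π ρ₂ k j)
  Match π (ρ *) i j = Star (Match π ρ) i j

_⊨_ : ∀ {n} → Trace n → Form n → Set
π ⊨ φ = Sat π 0 φ

end : ∀ {n} → Form n
end = [ prop ptrue ]' ff

data RE (n : ℕ) : Set where
  lit : Prop n → RE n
  _+ʳ_ _⨾ʳ_ : RE n → RE n → RE n
  _*ʳ : RE n → RE n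

data StarL {n} (L : Trace n → Set) : Trace n → Set where
  nil  : StarL L []
  cons : ∀ {u v} → L u → StarL L v → StarL L (u ++ v)

Lang : ∀ {n} → RE n → Trace n → Set
Lang (lit φ) w = ∃[ Π ] (w ≡ [ Π ] × Π ⊨ₚ φ)
Lang (r +ʳ s) w = Lang r w ⊎ Lang s w
Lang (r ⨾ʳ s) w = ∃[ u ] ∃[ v ] (w ≡ u ++ v × Lang r u × Lang s v)
Lang (r *ʳ) w = StarL (Lang r) w

toPath : ∀ {n} → RE n → Path n
toPath (lit φ) = prop φ
toPath (r +ʳ s) = toPath r +' toPath s
toPath (r ⨾ʳ s) = toPath r ⨾ toPath s
toPath (r *ʳ) = toPath r *

PossGood : ∀ {n} → Form n → Trace n → Set
PossGood φ π = ∃[ π' ] ((π ++ π') ⊨ φ)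

TempTrue TempFalse PermTrue PermFalse : ∀ {n} → Form n → Trace n → Set
TempTrue  φ π = (π ⊨ φ) × ∃[ π' ] (¬ ((π ++ π') ⊨ φ))
TempFalse φ π = (¬ (π ⊨ φ)) × ∃[ π' ] ((π ++ π') ⊨ φ)
PermTrue  φ π = (π ⊨ φ) × (∀ π' → (π ++ π') ⊨ φ)
PermFalse φ π = (¬ (π ⊨ φ)) × (∀ π' → ¬ ((π ++ π') ⊨ φ))

module Submission where

-- The theorem reduces to two facts about a fixed finite trace π.
--
-- (1) ⟨r⟩end characterises membership: for a test-free regular expression r,
--     π ⊨ ⟨r⟩end  iff  π ∈ ℒ(r).  We show that π(i,j) ∈ ℒ(toPath r) exactly
--     when π contains, from position i on, a word of ℒ(r) of length j − i
--     ('Reads'); 'end' holds exactly where π has no letter, so the word must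
--     be all of π.  Hence ⟨pref_φ⟩end expresses "π is a good prefix of φ".
--
-- (2) Satisfaction on a finite trace is decidable.  Every path step moves
--     forward within the trace or stays put ('Advance'), so every quantifier
--     in the semantics ranges over finitely many positions, and a Kleene star
--     is decided by searching for a first genuine step.  Decidability gives
--     double-negation stability, which the permanent states need
--     ("no bad extension" ⇒ "every extension is good").
--
-- The four equivalences are then pure logic about the two prefix predicates
-- ('rv-states'), and theorem3 instantiates that lemma with (1).

open import Defs
open import Data.Nat using (ℕ; zero; suc; _+_; _≤_; _<_; z≤n; s≤s; _≟_; _≤?_; _<?_)
open import Data.Nat.Properties
  using (≤-refl; <-trans; <-≤-trans; <⇒≱; n≤1+n; m≤m+n; +-suc; +-comm; +-assoc; +-identityʳ; +-monoʳ-≤; anyUpTo?)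
open import Data.List using ([]; _∷_; _++_; [_]; length)
open import Data.List.Properties using (++-identityʳ; length-++)
open import Data.Maybe using (Maybe; just; nothing)
open import Data.Product using (∃-syntax; _×_; _,_; proj₁; proj₂; map₂)
open import Data.Sum using (_⊎_; inj₁; inj₂)
open import Data.Unit using (⊤; tt)
open import Data.Empty using (⊥-elim)
open import Relation.Nullary using (¬_; Dec; yes; no; contradiction)
open import Relation.Nullary.Decidable using (_×-dec_; _⊎-dec_; ¬?; map′; decidable-stable; T?)
open import Relation.Binary.PropositionalEquality using (_≡_; refl; sym; trans; cong; subst)
open import Relation.Binary.Construct.Closure.ReflexiveTransitive using (Star; ε; _◅_)
open import Function.Bundles using (_⇔_; mk⇔; Equivalence)
open import Function.Construct.Composition using (_⇔-∘_)

-- A step from i to j either stays at i or moves strictly forward to a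
-- position ≤ L.  Path steps on a trace of length L all have this form.
Advance : ℕ → ℕ → ℕ → Set
Advance L i j = i ≡ j ⊎ (i < j × j ≤ L)

advance-trans : ∀ {L i k j} → Advance L i k → Advance L k j → Advance L i j
advance-trans (inj₁ refl) a = a
advance-trans (inj₂ p) (inj₁ refl) = inj₂ p
advance-trans (inj₂ (i<k , _)) (inj₂ (k<j , j≤L)) = inj₂ (<-trans i<k k<j , j≤L)

-- An existential over targets of advancing steps is decidable: only i and
-- the positions up to L need to be inspected.
∃-advance? : ∀ {L i} {P : ℕ → Set} → (∀ j → Dec (P j))
           → (∀ {j} → P j → Advance L i j) → Dec (∃[ j ] P j)
∃-advance? {L} {i} {P} P? advance with P? i | anyUpTo? P? (suc L)
... | yes p  | _               = yes (i , p)
... | no _   | yes (j , _ , p) = yes (j , p)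
... | no ¬pi | no ¬below       = no λ (j , p) → refute (advance p) p
  where
  refute : ∀ {j} → Advance L i j → ¬ P j
  refute (inj₁ refl)      = ¬pi
  refute (inj₂ (_ , j≤L)) p = ¬below (_ , s≤s j≤L , p)

-- Fuel bookkeeping for the star search: a strict step forward consumes one
-- unit of fuel while keeping L below fuel + position.
fuel-step : ∀ {L f i k} → L < suc f + i → i < k → L < f + k
fuel-step {f = f} {i} {k} bound i<k = <-≤-trans bound (subst (_≤ f + k) (+-suc f i) (+-monoʳ-≤ f i<k))

module StarDecidable {R : ℕ → ℕ → Set} (L : ℕ) (R? : ∀ i j → Dec (R i j))
                     (advance : ∀ {i j} → R i j → Advance L i j) (j : ℕ) where

  Progress : ℕ → ℕ → Set
  Progress i k = i < k × R i k × Star R k j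

  first-progress : ∀ {i} → Star R i j → i ≡ j ⊎ ∃[ k ] (k < suc L × Progress i k)
  first-progress ε = inj₁ refl
  first-progress (r ◅ s) with advance r
  ... | inj₁ refl         = first-progress s
  ... | inj₂ (i<k , k≤L)  = inj₂ (_ , s≤s k≤L , i<k , r , s)

  -- Decided by recursion on fuel f with L < f + i: each progress step
  -- consumes fuel, and without fuel no progress is possible.
  mutual
    star? : ∀ f i → L < f + i → Dec (Star R i j)
    star? f i bound with i ≟ j
    ... | yes refl = yes ε
    ... | no i≢j = map′ (λ (_ , _ , _ , r , s) → r ◅ s) progress (progress? f i bound)
      where
      progress : Star R i j → ∃[ k ] (k < suc L × Progress i k)
      progress s with first-progress s
      ... | inj₁ i≡j = contradiction i≡j i≢j
      ... | inj₂ p   = p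

    progress? : ∀ f i → L < f + i → Dec (∃[ k ] (k < suc L × Progress i k))
    progress? zero    i L<i   = no λ { (_ , s≤s k≤L , i<k , _) → <⇒≱ (<-trans L<i i<k) k≤L }
    progress? (suc f) i bound = anyUpTo? (step? f i bound) (suc L)

    step? : ∀ f i → L < suc f + i → ∀ k → Dec (Progress i k)
    step? f i bound k with i <? k
    ... | no i≮k  = no λ p → i≮k (proj₁ p)
    ... | yes i<k = map′ (i<k ,_) proj₂ (R? i k ×-dec star? f k (fuel-step bound i<k))

  star-dec : ∀ i → Dec (Star R i j)
  star-dec i = star? (suc L) i (m≤m+n (suc L) i)

prop? : ∀ {n} (Π : Letter n) (φ : Prop n) → Dec (Π ⊨ₚ φ)
prop? Π (atom p)   = T? (Π p)
prop? Π ptrue      = yes tt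
prop? Π pfalse     = no λ ()
prop? Π (pnot φ)   = ¬? (prop? Π φ)
prop? Π (pand φ ψ) = prop? Π φ ×-dec prop? Π ψ
prop? Π (por φ ψ)  = prop? Π φ ⊎-dec prop? Π ψ

letter? : ∀ {n} (φ : Prop n) (m : Maybe (Letter n)) → Dec (∃[ Π ] (m ≡ just Π × Π ⊨ₚ φ))
letter? φ nothing  = no λ { (_ , () , _) }
letter? φ (just Π) = map′ (λ p → Π , refl , p) (λ { (_ , refl , p) → p }) (prop? Π φ)

at-<length : ∀ {n} (π : Trace n) i {Π} → at π i ≡ just Π → i < length π
at-<length (x ∷ π) zero    _ = s≤s z≤n
at-<length (x ∷ π) (suc i) e = s≤s (at-<length π i e)

at-length : ∀ {n} (π : Trace n) → at π (length π) ≡ nothing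
at-length []      = refl
at-length (x ∷ π) = at-length π

module Decidability {n : ℕ} (π : Trace n) where

  mutual
    match-advances : ∀ ρ {i j} → Match π ρ i j → Advance (length π) i j
    match-advances (prop φ)  (refl , _ , e , _) = inj₂ (≤-refl , at-<length π _ e)
    match-advances (test φ)  (refl , _)         = inj₁ refl
    match-advances (ρ +' σ)  (inj₁ m)           = match-advances ρ m
    match-advances (ρ +' σ)  (inj₂ m)           = match-advances σ m
    match-advances (ρ ⨾ σ)   (_ , m₁ , m₂)      = advance-trans (match-advances ρ m₁) (match-advances σ m₂)
    match-advances (ρ *)     s                  = star-advances ρ s

    star-advances : ∀ ρ {i j} → Star (Match π ρ) i j → Advance (length π) i j
    star-advances ρ ε       = inj₁ refl
    star-advances ρ (m ◅ s) = advance-trans (match-advances ρ m) (star-advances ρ s)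

  mutual
    sat? : ∀ i φ → Dec (Sat π i φ)
    sat? i tt        = yes tt
    sat? i ff        = no λ ()
    sat? i (¬' φ)    = ¬? (sat? i φ)
    sat? i (φ ∧' ψ)  = sat? i φ ×-dec sat? i ψ
    sat? i (φ ∨' ψ)  = sat? i φ ⊎-dec sat? i ψ
    sat? i (⟨ ρ ⟩ φ) =
      ∃-advance? (λ j → (i ≤? j) ×-dec (match? ρ i j ×-dec sat? j φ))
                 (λ (_ , m , _) → match-advances ρ m)
    -- a box fails exactly when some reachable position is a counterexample
    sat? i ([ ρ ]' φ) =
      map′ (λ ¬cex j i≤j m → decidable-stable (sat? j φ) λ ¬s → ¬cex (j , i≤j , m , ¬s))
           (λ all (j , i≤j , m , ¬s) → ¬s (all j i≤j m))
           (¬? (∃-advance? (λ j → (i ≤? j) ×-dec (match? ρ i j ×-dec ¬? (sat? j φ)))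
                           (λ (_ , m , _) → match-advances ρ m)))

    match? : ∀ ρ i j → Dec (Match π ρ i j)
    match? (prop φ) i j = (j ≟ suc i) ×-dec letter? φ (at π i)
    match? (test φ) i j = (j ≟ i) ×-dec sat? i φ
    match? (ρ +' σ) i j = match? ρ i j ⊎-dec match? σ i j
    match? (ρ ⨾ σ)  i j = ∃-advance? (λ k → match? ρ i k ×-dec match? σ k j)
                                     (λ (m , _) → match-advances ρ m)
    match? (ρ *)    i j = StarDecidable.star-dec (length π) (match? ρ) (match-advances ρ) j i

open Decidability using (sat?)

Reads : ∀ {n} → Trace n → ℕ → Trace n → Set
Reads π i []      = ⊤
Reads π i (Π ∷ u) = at π i ≡ just Π × Reads π (suc i) u

reads-join : ∀ {n} (π : Trace n) i (u w : Trace n)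
           → Reads π i u → Reads π (i + length u) w → Reads π i (u ++ w)
reads-join π i []      w _        r = subst (λ k → Reads π k w) (+-identityʳ i) r
reads-join π i (Π ∷ u) w (e , ru) r =
  e , reads-join π (suc i) u w ru (subst (λ k → Reads π k w) (+-suc i (length u)) r)

reads-split : ∀ {n} (π : Trace n) i (u w : Trace n)
            → Reads π i (u ++ w) → Reads π i u × Reads π (i + length u) w
reads-split π i []      w r = tt , subst (λ k → Reads π k w) (sym (+-identityʳ i)) r
reads-split π i (Π ∷ u) w (e , r) with reads-split π (suc i) u w r
... | ru , rw = (e , ru) , subst (λ k → Reads π k w) (sym (+-suc i (length u))) rw

reads-cons : ∀ {n} {x} {π : Trace n} {i} u → Reads π i u → Reads (x ∷ π) (suc i) u
reads-cons []      _       = tt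
reads-cons (Π ∷ u) (e , r) = e , reads-cons u r

reads-uncons : ∀ {n} {x} {π : Trace n} {i} u → Reads (x ∷ π) (suc i) u → Reads π i u
reads-uncons []      _       = tt
reads-uncons (Π ∷ u) (e , r) = e , reads-uncons u r

reads-whole : ∀ {n} (π : Trace n) → Reads π 0 π
reads-whole []      = tt
reads-whole (x ∷ π) = refl , reads-cons π (reads-whole π)

reads-maximal : ∀ {n} (π u : Trace n) → Reads π 0 u → at π (length u) ≡ nothing → π ≡ u
reads-maximal []      []      _          _ = refl
reads-maximal []      (Π ∷ u) (() , _)
reads-maximal (x ∷ π) []      _          ()
reads-maximal (x ∷ π) (Π ∷ u) (refl , r) e = cong (x ∷_) (reads-maximal π u (reads-uncons u r) e)

+-length-++ : ∀ {n} i (u w : Trace n) → i + length u + length w ≡ i + length (u ++ w)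
+-length-++ i u w = trans (+-assoc i _ _) (cong (i +_) (sym (length-++ u)))

module Regular {n : ℕ} (π : Trace n) where

  Occurs : RE n → ℕ → ℕ → Set
  Occurs r i j = ∃[ u ] (Lang r u × Reads π i u × j ≡ i + length u)

  mutual
    match⇒occurs : ∀ r {i j} → Match π (toPath r) i j → Occurs r i j
    match⇒occurs (lit φ) {i} (refl , Π , e , p) = [ Π ] , (Π , refl , p) , (e , tt) , sym (+-comm i 1)
    match⇒occurs (r +ʳ s) (inj₁ m) with match⇒occurs r m
    ... | u , l , rd , e = u , inj₁ l , rd , e
    match⇒occurs (r +ʳ s) (inj₂ m) with match⇒occurs s m
    ... | u , l , rd , e = u , inj₂ l , rd , e
    match⇒occurs (r ⨾ʳ s) {i} (_ , m₁ , m₂) with match⇒occurs r m₁ | match⇒occurs s m₂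
    ... | u , l , ru , refl | w , l′ , rw , refl =
      u ++ w , (u , w , refl , l , l′) , reads-join π i u w ru rw , +-length-++ i u w
    match⇒occurs (r *ʳ) s = star⇒occurs r s

    star⇒occurs : ∀ r {i j} → Star (Match π (toPath r)) i j → Occurs (r *ʳ) i j
    star⇒occurs r {i} ε = [] , nil , tt , sym (+-identityʳ i)
    star⇒occurs r {i} (m ◅ s) with match⇒occurs r m | star⇒occurs r s
    ... | u , l , ru , refl | w , ls , rw , refl =
      u ++ w , cons l ls , reads-join π i u w ru rw , +-length-++ i u w

  mutual
    occurs⇒match : ∀ r {i u} → Lang r u → Reads π i u → Match π (toPath r) i (i + length u)
    occurs⇒match (lit φ) {i} (Π , refl , p) (e , _) = +-comm i 1 , Π , e , p
    occurs⇒match (r +ʳ s) (inj₁ l) rd = inj₁ (occurs⇒match r l rd)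
    occurs⇒match (r +ʳ s) (inj₂ l) rd = inj₂ (occurs⇒match s l rd)
    occurs⇒match (r ⨾ʳ s) {i} (u , w , refl , l , l′) rd with reads-split π i u w rd
    ... | ru , rw = i + length u , occurs⇒match r l ru
                  , subst (Match π (toPath s) (i + length u)) (+-length-++ i u w) (occurs⇒match s l′ rw)
    occurs⇒match (r *ʳ) ls rd = occurs⇒star r ls rd

    occurs⇒star : ∀ r {i u} → StarL (Lang r) u → Reads π i u → Star (Match π (toPath r)) i (i + length u)
    occurs⇒star r {i} nil _ = subst (Star _ i) (sym (+-identityʳ i)) ε
    occurs⇒star r {i} (cons {u} {w} l ls) rd with reads-split π i u w rd
    ... | ru , rw = occurs⇒match r l ru
                  ◅ subst (Star _ (i + length u)) (+-length-++ i u w) (occurs⇒star r ls rw)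

  end⇒no-letter : ∀ {j} → Sat π j end → at π j ≡ nothing
  end⇒no-letter {j} h with at π j
  ... | nothing = refl
  ... | just Π  = ⊥-elim (h (suc j) (n≤1+n j) (refl , Π , refl , tt))

  no-letter⇒end : ∀ {j} → at π j ≡ nothing → Sat π j end
  no-letter⇒end e _ _ (refl , Π , e′ , _) = contradiction (trans (sym e′) e) λ ()

  ⟨⟩end⇔Lang : ∀ r → (π ⊨ (⟨ toPath r ⟩ end)) ⇔ Lang r π
  ⟨⟩end⇔Lang r = mk⇔ to from
    where
    to : π ⊨ (⟨ toPath r ⟩ end) → Lang r π
    to (_ , _ , m , atEnd) with match⇒occurs r m
    ... | u , l , rd , refl = subst (Lang r) (sym (reads-maximal π u rd (end⇒no-letter atEnd))) l

    from : Lang r π → π ⊨ (⟨ toPath r ⟩ end)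
    from l = length π , z≤n , occurs⇒match r l (reads-whole π) , no-letter⇒end (at-length π)

open Regular using (⟨⟩end⇔Lang)

rv-states : ∀ {n} (φ : Form n) (π : Trace n) {Good Bad : Set}
          → Good ⇔ PossGood φ π → Bad ⇔ PossGood (¬' φ) π
          → (TempTrue φ π ⇔ ((π ⊨ φ) × Bad))
          × (TempFalse φ π ⇔ ((¬ (π ⊨ φ)) × Good))
          × (PermTrue φ π ⇔ (Good × ¬ Bad))
          × (PermFalse φ π ⇔ (Bad × ¬ Good))
rv-states φ π {Good} {Bad} good bad =
    mk⇔ (map₂ (from bad)) (map₂ (to bad))
  , mk⇔ (map₂ (from good)) (map₂ (to good))
  , mk⇔ (λ (_ , always) → from good ([] , always []) , λ b → let (π′ , ¬s) = to bad b in ¬s (always π′))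
        (λ (_ , ¬b) → unextend (always-good ¬b []) , always-good ¬b)
  , mk⇔ (λ (_ , never) → from bad ([] , never []) , λ g → let (π′ , s) = to good g in never π′ s)
        (λ (_ , ¬g) → (λ s → ¬g (from good ([] , extend s))) , λ π′ s → ¬g (from good (π′ , s)))
  where
  open Equivalence

  extend : π ⊨ φ → (π ++ []) ⊨ φ
  extend = subst (_⊨ φ) (sym (++-identityʳ π))

  unextend : (π ++ []) ⊨ φ → π ⊨ φ
  unextend = subst (_⊨ φ) (++-identityʳ π)

  -- Without a bad extension every extension satisfies φ; this uses that
  -- satisfaction is decidable, hence stable under double negation.
  always-good : ¬ Bad → ∀ π′ → (π ++ π′) ⊨ φ
  always-good ¬b π′ = decidable-stable (sat? (π ++ π′) 0 φ) λ ¬s → ¬b (from bad (π′ , ¬s))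

theorem3 : ∀ {n : ℕ} (φ : Form n) (prefφ pref¬φ : RE n)
    → (∀ π → Lang prefφ π ⇔ PossGood φ π)
    → (∀ π → Lang pref¬φ π ⇔ PossGood (¬' φ) π)
    → ∀ (π : Trace n)
    → (TempTrue φ π ⇔ (π ⊨ (φ ∧' (⟨ toPath pref¬φ ⟩ end))))
      × (TempFalse φ π ⇔ (π ⊨ (¬' φ ∧' (⟨ toPath prefφ ⟩ end))))
      × (PermTrue φ π ⇔ (π ⊨ ((⟨ toPath prefφ ⟩ end) ∧' ¬' (⟨ toPath pref¬φ ⟩ end))))
      × (PermFalse φ π ⇔ (π ⊨ ((⟨ toPath pref¬φ ⟩ end) ∧' ¬' (⟨ toPath prefφ ⟩ end))))
theorem3 φ prefφ pref¬φ prefφ-correct pref¬φ-correct π =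
  rv-states φ π (prefφ-correct π ⇔-∘ ⟨⟩end⇔Lang π prefφ)
                (pref¬φ-correct π ⇔-∘ ⟨⟩end⇔Lang π pref¬φ)
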